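{- Let $k \ge 4$ and let $G$ be an $SQSR(n, k, 0; k-1, k-2, k-3)$ graph. If $n = 2k+3$, then $k = 4$.
   Context: All graphs are finite and simple. A $QSR(n,k,a;c_1,\ldots,c_p)$ graph is a $k$-regular graph on $n$ vertices such that any two adjacent vertices have exactly $a$ common neighbours and any two distinct non-adjacent vertices have exactly $c_i$ common neighbours for some $1 \le i \le p$. Its grade is the number of indices $i$ for which there actually exist two non-adjacent vertices with exactly $c_i$ common neighbours; it is proper if its grade is $p$. An $SQSR(n,k,a;c_1,\ldots,c_p)$ graph is a proper $QSR(n,k,a;c_1,\ldots,c_p)$ graph in which $a, c_1, \ldots, c_p$ are pairwise distinct. -}

module Defs where

open import Data.Nat using (ℕ; zero; suc; _+_; _∸_)
open import Data.Bool using (Bool; true; false; _∧_; T; not)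
open import Data.Fin using (Fin)
open import Data.List using (List; allFin; filter; length; _∷_; lookup)
open import Data.List.Membership.Propositional using (_∈_)
open import Data.List.Relation.Unary.Unique.Propositional using (Unique)
open import Data.Product using (Σ; ∃; _×_; _,_)
open import Relation.Binary.PropositionalEquality using (_≡_; _≢_)
open import Relation.Nullary using (¬_)
open import Relation.Nullary.Decidable using (does)
open import Data.Bool.Properties using (T?)

record Graph (n : ℕ) : Set where
  field
    adj    : Fin n → Fin n → Bool
    sym    : ∀ u v → adj u v ≡ adj v u
    irrefl : ∀ v → adj v v ≡ false
open Graph public

count : {n : ℕ} → (Fin n → Bool) → ℕ
count {n} p = length (filter (λ w → T? (p w)) (allFin n))

degree : {n : ℕ} → Graph n → Fin n → ℕ
degree G v = count (adj G v)

common : {n : ℕ} → Graph n → Fin n → Fin n → ℕ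
common G u v = count (λ w → adj G u w ∧ adj G v w)

Adjacent : {n : ℕ} → Graph n → Fin n → Fin n → Set
Adjacent G u v = adj G u v ≡ true

NonAdjacentDistinct : {n : ℕ} → Graph n → Fin n → Fin n → Set
NonAdjacentDistinct G u v = (u ≢ v) × (adj G u v ≡ false)

-- QSR(n,k,a;c_1,...,c_p): the list cs = [c_1,...,c_p]
IsQSR : (n k a : ℕ) → List ℕ → Graph n → Set
IsQSR n k a cs G =
    (∀ v → degree G v ≡ k)
  × (∀ u v → Adjacent G u v → common G u v ≡ a)
  × (∀ u v → NonAdjacentDistinct G u v → common G u v ∈ cs)

-- proper: every index i has a realizing pair of distinct non-adjacent vertices
-- (i.e. the grade equals p)
IsProper : {n : ℕ} → Graph n → List ℕ → Set
IsProper {n} G cs =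
  ∀ (i : Fin (length cs)) →
    Σ (Fin n) λ u → Σ (Fin n) λ v →
      NonAdjacentDistinct G u v × (common G u v ≡ lookup cs i)

IsSQSR : (n k a : ℕ) → List ℕ → Graph n → Set
IsSQSR n k a cs G = IsQSR n k a cs G × IsProper G cs × Unique (a ∷ cs)

module Submission where

-- Fix an edge uv. By triangle-freeness N(u) and N(v) are disjoint, so exactly
-- n − 2k = 3 vertices are remote (adjacent to neither). A remote r has at least
-- k − 3 common neighbours with each of u and v among its k neighbours, so k ≤ 6.
-- Summing degrees, (2k + 3)k is even, so k is even and k ≠ 5. If k = 6, each remote r
-- has no remote neighbour and 3 neighbours in N(u); a neighbour b ∈ N(v) of r avoids
-- those 3 (no triangles), so its 6 neighbours include all 3 remote vertices. Hence any
-- two remote vertices share all 6 neighbours, while non-adjacent pairs share at most 5.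

open import Defs hiding (sym)
open import Data.Bool using (Bool; true; false; _∧_; not)
open import Data.Bool.Properties using (T?; ∧-comm; ∧-assoc; ∧-zeroʳ; ∧-identityʳ; ¬-not)
open import Data.Empty using (⊥; ⊥-elim)
open import Data.Fin using (Fin; zero; suc; fromℕ<)
import Data.Fin.Properties as Finₚ
open import Data.List using ([]; _∷_; filter; length; tabulate)
open import Data.List.Membership.Propositional using (_∈_)
open import Data.List.Relation.Unary.Any using (here; there)
open import Data.Nat using (ℕ; zero; suc; _+_; _*_; _∸_; _≤_; _<_; z≤n; s≤s; s≤s⁻¹)
open import Data.Nat.Divisibility using (_∣_; divides; _∣0; ∣m∣n⇒∣m+n; ∣m+n∣m⇒∣n; m∣m*n; n∣m⇒m%n≡0)
open import Data.Nat.Properties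
open import Data.Nat.Tactic.RingSolver using (solve-∀)
open import Data.Product using (Σ; _×_; _,_; proj₁; proj₂)
open import Function using (_∘_)
open import Relation.Binary.PropositionalEquality
open import Relation.Nullary using (contradiction)

open import Algebra.Properties.CommutativeMonoid.Sum +-0-commutativeMonoid using (sum; sum-cong-≗; ∑-distrib-+)
open import Algebra.Properties.CommutativeSemigroup +-commutativeSemigroup
  using () renaming (interchange to +-interchange; x∙yz≈y∙xz to +-left-comm)

∧-intro : ∀ {a b} → a ≡ true → b ≡ true → a ∧ b ≡ true
∧-intro refl refl = refl

∧-elim : ∀ {a b} → a ∧ b ≡ true → a ≡ true × b ≡ true
∧-elim {true} {true} _ = refl , refl

indicator : Bool → ℕ
indicator true  = 1
indicator false = 0

-- Generalises allFin n = tabulate id, so that the induction goes through.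
private
  count-tabulate : ∀ {m n} (p : Fin n → Bool) (f : Fin m → Fin n) →
                   length (filter (λ w → T? (p w)) (tabulate f)) ≡ count (p ∘ f)
  count-tabulate {zero}  p f = refl
  count-tabulate {suc m} p f with p (f zero)
  ... | true  = cong suc (trans (count-tabulate p (f ∘ suc)) (sym (count-tabulate (p ∘ f) suc)))
  ... | false = trans (count-tabulate p (f ∘ suc)) (sym (count-tabulate (p ∘ f) suc))

count-suc : ∀ {n} (p : Fin (suc n) → Bool) → count p ≡ indicator (p zero) + count (p ∘ suc)
count-suc p with p zero
... | true  = cong suc (count-tabulate p suc)
... | false = count-tabulate p suc

count-cong : ∀ {n} {p q : Fin n → Bool} → (∀ w → p w ≡ q w) → count p ≡ count q
count-cong {zero}          _   = refl
count-cong {suc n} {p} {q} p≗q = begin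
  count p                               ≡⟨ count-suc p ⟩
  indicator (p zero) + count (p ∘ suc)  ≡⟨ cong₂ _+_ (cong indicator (p≗q zero)) (count-cong (p≗q ∘ suc)) ⟩
  indicator (q zero) + count (q ∘ suc)  ≡⟨ count-suc q ⟨
  count q                               ∎
  where open ≡-Reasoning

indicator-mono : ∀ {a b} → (a ≡ true → b ≡ true) → indicator a ≤ indicator b
indicator-mono {false}         _   = z≤n
indicator-mono {true}  {true}  _   = ≤-refl
indicator-mono {true}  {false} a⇒b with () ← a⇒b refl

count-mono : ∀ {n} {p q : Fin n → Bool} → (∀ w → p w ≡ true → q w ≡ true) → count p ≤ count q
count-mono {zero}          _   = z≤n
count-mono {suc n} {p} {q} p⊆q = subst₂ _≤_ (sym (count-suc p)) (sym (count-suc q))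
  (+-mono-≤ (indicator-mono (p⊆q zero)) (count-mono (p⊆q ∘ suc)))

indicator-split : ∀ a b → indicator a ≡ indicator (a ∧ b) + indicator (a ∧ not b)
indicator-split false _     = refl
indicator-split true  true  = refl
indicator-split true  false = refl

count-split : ∀ {n} (p q : Fin n → Bool) →
              count p ≡ count (λ w → p w ∧ q w) + count (λ w → p w ∧ not (q w))
count-split {zero}  p q = refl
count-split {suc n} p q = begin
  count p                                       ≡⟨ count-suc p ⟩
  indicator (p zero) + count (p ∘ suc)          ≡⟨ cong₂ _+_ (indicator-split (p zero) (q zero))
                                                             (count-split (p ∘ suc) (q ∘ suc)) ⟩
  (a + b) + (c + d)                             ≡⟨ +-interchange a b c d ⟩
  (a + c) + (b + d)                             ≡⟨ cong₂ _+_ (count-suc (λ w → p w ∧ q w)) (count-suc (λ w → p w ∧ not (q w))) ⟨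
  count (λ w → p w ∧ q w) + count (λ w → p w ∧ not (q w)) ∎
  where
  open ≡-Reasoning
  a b c d : ℕ
  a = indicator (p zero ∧ q zero)
  b = indicator (p zero ∧ not (q zero))
  c = count (λ w → p (suc w) ∧ q (suc w))
  d = count (λ w → p (suc w) ∧ not (q (suc w)))

count-positive : ∀ {n} (p : Fin n → Bool) {w} → p w ≡ true → 0 < count p
count-positive p {zero}  pw rewrite count-suc p | pw = s≤s z≤n
count-positive p {suc w} pw rewrite count-suc p =
  ≤-trans (count-positive (p ∘ suc) pw) (m≤n+m _ (indicator (p zero)))

count-witness : ∀ {n} (p : Fin n → Bool) → 0 < count p → Σ (Fin n) λ w → p w ≡ true
count-witness {zero}  p ()
count-witness {suc n} p 0<count with p zero in p0 | count-suc p
... | true  | _ = zero , p0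
... | false | eq with w , pw ← count-witness (p ∘ suc) (subst (0 <_) eq 0<count) = suc w , pw

count-two-witnesses : ∀ {n} (p : Fin n → Bool) → 1 < count p →
                      Σ (Fin n) λ x → Σ (Fin n) λ y → x ≢ y × p x ≡ true × p y ≡ true
count-two-witnesses {zero}  p ()
count-two-witnesses {suc n} p 1<count with p zero in p0 | count-suc p
... | true  | eq with w , pw ← count-witness (p ∘ suc) (s≤s⁻¹ (subst (1 <_) eq 1<count)) =
  zero , suc w , (λ ()) , p0 , pw
... | false | eq with x , y , x≢y , px , py ← count-two-witnesses (p ∘ suc) (subst (1 <_) eq 1<count) =
  suc x , suc y , x≢y ∘ Finₚ.suc-injective , px , py

count-true : ∀ {n} → count {n} (λ _ → true) ≡ n
count-true {zero}  = refl
count-true {suc n} = trans (count-suc {n} (λ _ → true)) (cong suc count-true)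

count-saturated : ∀ {n} {p q : Fin n → Bool} → (∀ w → p w ≡ true → q w ≡ true) →
                  count q ≤ count p → ∀ w → q w ≡ true → p w ≡ true
count-saturated {p = p} {q} p⊆q q≤p w qw with p w in pw
... | true  = refl
... | false = contradiction q≤p (<⇒≱ p<q)
  where
  p≤q∧p : count p ≤ count (λ x → q x ∧ p x)
  p≤q∧p = count-mono λ x px → ∧-intro (p⊆q x px) px
  q∧¬p>0 : 0 < count (λ x → q x ∧ not (p x))
  q∧¬p>0 = count-positive (λ x → q x ∧ not (p x)) (∧-intro qw (cong not pw))
  p<q : count p < count q
  p<q = subst (count p <_) (sym (count-split q p)) (≤-<-trans p≤q∧p (m<m+n _ q∧¬p>0))

sum-indicator : ∀ {n} (p : Fin n → Bool) → sum (indicator ∘ p) ≡ count p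
sum-indicator {zero}  p = refl
sum-indicator {suc n} p = trans (cong (indicator (p zero) +_) (sum-indicator (p ∘ suc))) (sym (count-suc p))

2∣m+m : ∀ m → 2 ∣ m + m
2∣m+m m = divides m (trans (cong (m +_) (sym (+-identityʳ m))) (*-comm 2 m))

handshake : ∀ {n} (A : Fin n → Fin n → Bool) → (∀ u v → A u v ≡ A v u) → (∀ v → A v v ≡ false) →
            2 ∣ sum (λ v → count (A v))
handshake {zero}  A _     _     = 2 ∣0
handshake {suc n} A A-sym A-irr =
  subst (2 ∣_) (sym total) (∣m∣n⇒∣m+n (2∣m+m d) (handshake A′ (λ u v → A-sym (suc u) (suc v)) (A-irr ∘ suc)))
  where
  A′ : Fin n → Fin n → Bool
  A′ u v = A (suc u) (suc v)
  d rest : ℕ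
  d = count (A zero ∘ suc)
  rest = sum (λ v → count (A′ v))
  total : sum (λ v → count (A v)) ≡ (d + d) + rest
  total = begin
    count (A zero) + sum (λ v → count (A (suc v)))
      ≡⟨ cong₂ _+_ (count-suc (A zero)) (sum-cong-≗ (count-suc ∘ A ∘ suc)) ⟩
    (indicator (A zero zero) + d) + sum (λ v → indicator (A (suc v) zero) + count (A′ v))
      ≡⟨ cong₂ _+_ (cong (λ b → indicator b + d) (A-irr zero)) (∑-distrib-+ {n} _ _) ⟩
    d + (sum (λ v → indicator (A (suc v) zero)) + rest)
      ≡⟨ cong (λ x → d + (x + rest)) (trans (sum-indicator {n} _) (count-cong (λ v → A-sym (suc v) zero))) ⟩
    d + (d + rest)
      ≡⟨ +-assoc d d rest ⟨
    (d + d) + rest ∎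
    where open ≡-Reasoning

sum-const : ∀ n k → sum {n} (λ _ → k) ≡ n * k
sum-const zero    k = refl
sum-const (suc n) k = cong (k +_) (sum-const n k)

adjacent-sym : ∀ {n} {G : Graph n} {u v} → Adjacent G u v → Adjacent G v u
adjacent-sym {G = G} {u} {v} uv = trans (Graph.sym G v u) uv

TriangleFree : ∀ {n} → Graph n → Set
TriangleFree G = ∀ u v → Adjacent G u v → common G u v ≡ 0

Regular : ∀ {n} → ℕ → Graph n → Set
Regular k G = ∀ v → degree G v ≡ k

remote : ∀ {n} → Graph n → Fin n → Fin n → Fin n → Bool
remote G u v w = not (adj G u w) ∧ not (adj G v w)

regular⇒2∣n*k : ∀ {n k} (G : Graph n) → Regular k G → 2 ∣ n * k
regular⇒2∣n*k {n} {k} G regular =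
  subst (2 ∣_) (trans (sum-cong-≗ regular) (sum-const n k)) (handshake (adj G) (Graph.sym G) (irrefl G))

common-comm : ∀ {n} (G : Graph n) u v → common G u v ≡ common G v u
common-comm G u v = count-cong (λ w → ∧-comm (adj G u w) (adj G v w))

module TriangleFreeGraph {n} (G : Graph n) (triangle-free : TriangleFree G) where

  no-triangle : ∀ {u v w} → Adjacent G u v → Adjacent G u w → Adjacent G v w → ⊥
  no-triangle {u} {v} uv uw vw
    with () ← subst (0 <_) (triangle-free u v uv) (count-positive (λ x → adj G u x ∧ adj G v x) (∧-intro uw vw))

  count-partition : ∀ {u v} → Adjacent G u v → (p : Fin n → Bool) →
    count p ≡ count (λ w → p w ∧ adj G u w) + count (λ w → p w ∧ adj G v w) + count (λ w → p w ∧ remote G u v w)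
  count-partition {u} {v} uv p = begin
    count p                                ≡⟨ count-split p (adj G u) ⟩
    inU + count p∖u                        ≡⟨ cong (inU +_) (count-split p∖u (adj G v)) ⟩
    inU + (count (λ w → p∖u w ∧ adj G v w) + count (λ w → p∖u w ∧ not (adj G v w)))
                                           ≡⟨ cong₂ (λ x y → inU + (x + y)) (count-cong λ w → drop-¬u (p w) refl refl)
                                                                             (count-cong λ w → ∧-assoc (p w) _ _) ⟩
    inU + (inV + inR)                      ≡⟨ +-assoc inU inV inR ⟨
    inU + inV + inR                        ∎
    where
    open ≡-Reasoning
    inU inV inR : ℕ
    inU = count (λ w → p w ∧ adj G u w)
    inV = count (λ w → p w ∧ adj G v w)
    inR = count (λ w → p w ∧ remote G u v w)
    p∖u : Fin n → Bool
    p∖u w = p w ∧ not (adj G u w)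
    drop-¬u : ∀ {w} a {b c} → adj G u w ≡ b → adj G v w ≡ c → (a ∧ not b) ∧ c ≡ a ∧ c
    drop-¬u a {false} _  _  = cong (_∧ _) (∧-identityʳ a)
    drop-¬u a {true} {false} _ _ = trans (∧-zeroʳ _) (sym (∧-zeroʳ a))
    drop-¬u a {true} {true} uw vw = ⊥-elim (no-triangle uv uw vw)

  remote-nonadjacent : ∀ {u v r} → Adjacent G u v → remote G u v r ≡ true →
                       NonAdjacentDistinct G r u × NonAdjacentDistinct G r v
  remote-nonadjacent {u} {v} {r} uv rem with adj G u r in ur | adj G v r in vr | rem
  ... | false | false | _ = (r≢u , trans (Graph.sym G r u) ur) , (r≢v , trans (Graph.sym G r v) vr)
    where
    r≢u : r ≢ u
    r≢u refl with () ← trans (sym vr) (trans (Graph.sym G v r) uv)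
    r≢v : r ≢ v
    r≢v refl with () ← trans (sym ur) uv

  module _ {k} (regular : Regular k G) where

    degree-partition : ∀ {u v} → Adjacent G u v → ∀ x →
                       k ≡ common G x u + common G x v + count (λ w → adj G x w ∧ remote G u v w)
    degree-partition uv x = trans (sym (regular x)) (count-partition uv (adj G x))

    count-remote : ∀ {u v} → Adjacent G u v → k + k + count (remote G u v) ≡ n
    count-remote {u} {v} uv = begin
      k + k + count (remote G u v)                     ≡⟨ cong₂ (λ a b → a + b + count (remote G u v)) (regular u) (regular v) ⟨
      degree G u + degree G v + count (remote G u v)   ≡⟨ count-partition uv (λ _ → true) ⟨
      count {n} (λ _ → true)                           ≡⟨ count-true ⟩
      n                                                ∎
      where open ≡-Reasoning

    count-remote≡3 : n ≡ 2 * k + 3 → ∀ {u v} → Adjacent G u v → count (remote G u v) ≡ 3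
    count-remote≡3 n≡2k+3 {u} {v} uv = +-cancelˡ-≡ (k + k) (count (remote G u v)) 3
      (trans (count-remote uv) (trans n≡2k+3 (cong (λ m → k + m + 3) (+-identityʳ k))))

    edge : 0 < n → 0 < k → Σ (Fin n) λ u → Σ (Fin n) (Adjacent G u)
    edge 0<n 0<k = let u = fromℕ< 0<n in u , count-witness (adj G u) (subst (0 <_) (sym (regular u)) 0<k)

    common≤remote-neighbours : ∀ {u v r b} → Adjacent G u v → Adjacent G v b → Adjacent G r b →
                               common G u r ≤ count (λ w → adj G b w ∧ remote G u v w)
    common≤remote-neighbours {u} {v} {r} {b} uv vb rb = +-cancelˡ-≤ bu (common G u r) bR (begin
      bu + common G u r                ≡⟨ +-comm bu (common G u r) ⟩
      common G u r + bu                ≤⟨ +-monoʳ-≤ (common G u r) bu≤u∖r ⟩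
      common G u r + count u∖r         ≡⟨ trans (sym (regular u)) (count-split (adj G u) (adj G r)) ⟨
      k                                ≡⟨ degree-partition uv b ⟩
      bu + common G b v + bR           ≡⟨ cong (λ c → bu + c + bR) (triangle-free b v (adjacent-sym {G = G} vb)) ⟩
      bu + 0 + bR                      ≡⟨ cong (_+ bR) (+-identityʳ bu) ⟩
      bu + bR                          ∎)
      where
      open ≤-Reasoning
      bu bR : ℕ
      bu = common G b u
      bR = count (λ w → adj G b w ∧ remote G u v w)
      u∖r : Fin n → Bool
      u∖r w = adj G u w ∧ not (adj G r w)
      bu≤u∖r : bu ≤ count u∖r
      bu≤u∖r = count-mono {p = λ w → adj G b w ∧ adj G u w} λ w buw → let bw , uw = ∧-elim buw in
        ∧-intro uw (cong not (¬-not λ rw → no-triangle rb rw bw))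

    module _ (lower : ∀ x y → NonAdjacentDistinct G x y → k ≤ 3 + common G x y) where

      k+k≤6+commons : ∀ {u v r} → Adjacent G u v → remote G u v r ≡ true →
                      k + k ≤ 6 + (common G r u + common G r v)
      k+k≤6+commons {u} {v} {r} uv rem = begin
        k + k                                       ≤⟨ +-mono-≤ (lower r u ru) (lower r v rv) ⟩
        (3 + common G r u) + (3 + common G r v)     ≡⟨ cong (3 +_) (+-left-comm (common G r u) 3 (common G r v)) ⟩
        6 + (common G r u + common G r v)           ∎
        where
        open ≤-Reasoning
        ru : NonAdjacentDistinct G r u
        ru = proj₁ (remote-nonadjacent uv rem)
        rv : NonAdjacentDistinct G r v
        rv = proj₂ (remote-nonadjacent uv rem)

      degree≤6 : ∀ {u v} → Adjacent G u v → 0 < count (remote G u v) → k ≤ 6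
      degree≤6 {u} {v} uv R≢∅ with r , rem ← count-witness (remote G u v) R≢∅ =
        +-cancelˡ-≤ k k 6 (begin
          k + k                              ≤⟨ k+k≤6+commons uv rem ⟩
          6 + (common G r u + common G r v)  ≤⟨ +-monoʳ-≤ 6 (m≤m+n _ _) ⟩
          6 + (common G r u + common G r v + count (λ w → adj G r w ∧ remote G u v w))
                                             ≡⟨ cong (6 +_) (degree-partition uv r) ⟨
          6 + k                              ≡⟨ +-comm 6 k ⟩
          k + 6                              ∎)
        where open ≤-Reasoning

      remote-independent : 6 ≤ k → ∀ {u v r w} → Adjacent G u v →
                           remote G u v r ≡ true → remote G u v w ≡ true → adj G r w ≡ false
      remote-independent 6≤k {u} {v} {r} {w} uv remr remw =
        ¬-not λ rw → <⇒≱ (count-positive (λ x → adj G r x ∧ remote G u v x) (∧-intro rw remw)) rR≤0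
        where
        open ≤-Reasoning
        rR : ℕ
        rR = count (λ x → adj G r x ∧ remote G u v x)
        rR≤0 : rR ≤ 0
        rR≤0 = +-cancelˡ-≤ (k + k) rR 0 (begin
          k + k + rR                                        ≤⟨ +-monoˡ-≤ rR (k+k≤6+commons uv remr) ⟩
          6 + (common G r u + common G r v) + rR            ≡⟨ +-assoc 6 _ rR ⟩
          6 + (common G r u + common G r v + rR)            ≡⟨ cong (6 +_) (degree-partition uv r) ⟨
          6 + k                                             ≤⟨ +-monoˡ-≤ k 6≤k ⟩
          k + k                                             ≡⟨ +-identityʳ (k + k) ⟨
          k + k + 0                                         ∎)

      remote-saturating : ∀ {u v r b r′} → Adjacent G u v → 3 + count (remote G u v) ≤ k →
                          remote G u v r ≡ true → Adjacent G v b → Adjacent G r b →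
                          remote G u v r′ ≡ true → Adjacent G b r′
      remote-saturating {u} {v} {r} {b} {r′} uv 3+R≤k rem vb rb rem′ =
        proj₁ (∧-elim (count-saturated {p = λ w → adj G b w ∧ remote G u v w}
                        (λ w bw∧rw → proj₂ (∧-elim {adj G b w} bw∧rw)) R≤bR r′ rem′))
        where
        R≤common : count (remote G u v) ≤ common G u r
        R≤common = +-cancelˡ-≤ 3 _ _ (≤-trans 3+R≤k
          (subst (λ c → k ≤ 3 + c) (common-comm G r u) (lower r u (proj₁ (remote-nonadjacent uv rem)))))
        R≤bR : count (remote G u v) ≤ count (λ w → adj G b w ∧ remote G u v w)
        R≤bR = ≤-trans R≤common (common≤remote-neighbours uv vb rb)

      remote-twins : 6 ≤ k → ∀ {u v} → Adjacent G u v → 3 + count (remote G u v) ≤ k → 1 < count (remote G u v) →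
                     Σ (Fin n) λ r₁ → Σ (Fin n) λ r₂ → NonAdjacentDistinct G r₁ r₂ × k ≤ common G r₁ r₂
      remote-twins 6≤k {u} {v} uv 3+R≤k 1<R
        with r₁ , r₂ , r₁≢r₂ , rem₁ , rem₂ ← count-two-witnesses (remote G u v) 1<R =
        r₁ , r₂ , (r₁≢r₂ , remote-independent 6≤k uv rem₁ rem₂) ,
        subst (_≤ common G r₁ r₂) (regular r₁) (count-mono {p = adj G r₁} λ w r₁w → ∧-intro r₁w (adjacent-sym {G = G} (r₂-adjacent r₁w)))
        where
        flip : ∀ {w} → remote G u v w ≡ true → remote G v u w ≡ true
        flip {w} rem = trans (∧-comm (not (adj G v w)) (not (adj G u w))) rem
        3+R′≤k : 3 + count (remote G v u) ≤ k
        3+R′≤k = subst (λ c → 3 + c ≤ k) (count-cong λ w → ∧-comm (not (adj G u w)) (not (adj G v w))) 3+R≤k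
        r₂-adjacent : ∀ {w} → Adjacent G r₁ w → Adjacent G w r₂
        r₂-adjacent {w} r₁w with adj G u w in uw | adj G v w in vw
        ... | _     | true  = remote-saturating uv 3+R≤k rem₁ vw r₁w rem₂
        ... | true  | false = remote-saturating (adjacent-sym {G = G} uv) 3+R′≤k (flip rem₁) uw r₁w (flip rem₂)
        ... | false | false with () ← trans (sym r₁w) (remote-independent 6≤k uv rem₁ (∧-intro (cong not uw) (cong not vw)))

qsr-common-bounds : ∀ {k c} → 3 ≤ k → c ∈ (k ∸ 1 ∷ k ∸ 2 ∷ k ∸ 3 ∷ []) → k ≤ 3 + c × c < k
qsr-common-bounds (s≤s (s≤s (s≤s {n = j} _))) c∈ with c∈
... | here refl                 = s≤s (s≤s (s≤s (m≤n+m j 2))) , ≤-refl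
... | there (here refl)         = s≤s (s≤s (s≤s (m≤n+m j 1))) , n≤1+n _
... | there (there (here refl)) = ≤-refl , m≤n+m (suc j) 2

regular-of-order-2k+3⇒2∣k : ∀ {n k} (G : Graph n) → Regular k G → n ≡ 2 * k + 3 → 2 ∣ k
regular-of-order-2k+3⇒2∣k {k = k} G regular refl =
  ∣m+n∣m⇒∣n (subst (2 ∣_) (expand k) (regular⇒2∣n*k G regular)) (m∣m*n (k * k + k))
  where
  expand : ∀ k → (2 * k + 3) * k ≡ 2 * (k * k + k) + k
  expand = solve-∀

4≤even<6⇒≡4 : ∀ {k} → 4 ≤ k → k < 6 → 2 ∣ k → k ≡ 4
4≤even<6⇒≡4 (s≤s (s≤s (s≤s (s≤s {n = 0} _)))) _ _ = refl
4≤even<6⇒≡4 (s≤s (s≤s (s≤s (s≤s {n = 1} _)))) _ 2∣5 with () ← n∣m⇒m%n≡0 5 2 2∣5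
4≤even<6⇒≡4 (s≤s (s≤s (s≤s (s≤s {n = suc (suc _)} _)))) (s≤s (s≤s (s≤s (s≤s (s≤s (s≤s ())))))) _

mainTheorem13 : (n k : ℕ) → 4 ≤ k → (G : Graph n) →
    IsSQSR n k 0 (k ∸ 1 ∷ k ∸ 2 ∷ k ∸ 3 ∷ []) G →
    n ≡ 2 * k + 3 → k ≡ 4
mainTheorem13 n k 4≤k G ((regular , triangle-free , nonadjacent) , _ , _) n≡2k+3 =
  let _ , _ , uv = edge regular 0<n (≤-trans (s≤s z≤n) 4≤k)
  in 4≤even<6⇒≡4 4≤k (≤∧≢⇒< (k≤6 uv) (k≢6 uv)) (regular-of-order-2k+3⇒2∣k G regular n≡2k+3)
  where
  open TriangleFreeGraph G triangle-free
  0<n : 0 < n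
  0<n = subst (0 <_) (sym (trans n≡2k+3 (+-comm (2 * k) 3))) (s≤s z≤n)
  bounds : ∀ x y → NonAdjacentDistinct G x y → k ≤ 3 + common G x y × common G x y < k
  bounds x y x≁y = qsr-common-bounds (≤-trans (n≤1+n 3) 4≤k) (nonadjacent x y x≁y)
  lower : ∀ x y → NonAdjacentDistinct G x y → k ≤ 3 + common G x y
  lower x y = proj₁ ∘ bounds x y
  k≤6 : ∀ {u v} → Adjacent G u v → k ≤ 6
  k≤6 uv = degree≤6 regular lower uv (subst (0 <_) (sym (count-remote≡3 regular n≡2k+3 uv)) (s≤s z≤n))
  k≢6 : ∀ {u v} → Adjacent G u v → k ≢ 6
  k≢6 uv k≡6 =
    let R≡3 = count-remote≡3 regular n≡2k+3 uv
        r₁ , r₂ , r₁≁r₂ , k≤common = remote-twins regular lower (≤-reflexive (sym k≡6)) uv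
                                       (≤-reflexive (trans (cong (3 +_) R≡3) (sym k≡6)))
                                       (subst (1 <_) (sym R≡3) (s≤s (s≤s z≤n)))
    in <⇒≱ (proj₂ (bounds r₁ r₂ r₁≁r₂)) k≤common
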